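{- There exists a list $I=(x_1,\ldots,x_n)$ of items such that \[ \mathbb{E}[\mathrm{BF}(I^\sigma)] = \tfrac{13}{10}\,\mathrm{OPT}(I), \] where $\sigma$ is drawn uniformly at random from $\mathcal{S}_n$.
   Context: Bin packing: a list of items with sizes in $(0,1]$ must be assigned to unit-capacity bins so that each bin's total size is at most $1$. $\mathrm{OPT}(I)$ is the minimum number of bins needed to pack $I$. Best Fit ($\mathrm{BF}$) is the online algorithm that processes items in list order and packs the current item into the fullest already-open bin in which it fits, opening a new bin if it fits in none; $\mathrm{BF}(I)$ denotes the number of bins it uses. $\mathcal{S}_n$ is the set of permutations of $\{1,\ldots,n\}$, and $I^\sigma=(x_{\sigma(1)},\ldots,x_{\sigma(n)})$. -}

module Defs where

open import Data.Nat using (ℕ; zero; suc; _<_)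
open import Data.Fin using (Fin; _≟_)
open import Data.List using (List; []; _∷_; _++_; [_]; length; map; foldl; concatMap; lookup; allFin)
open import Data.Maybe using (Maybe; just; nothing)
open import Data.Product using (Σ; _×_)
open import Data.Rational using (ℚ; 0ℚ; 1ℚ; _+_; _≤_; _<_)
import Data.Rational as Q
open import Relation.Nullary using (¬_; yes; no)

sumℚ : List ℚ → ℚ
sumℚ [] = 0ℚ
sumℚ (x ∷ xs) = x + sumℚ xs

ValidItems : List ℚ → Set
ValidItems [] = Data.Unit.⊤ where import Data.Unit
ValidItems (x ∷ xs) = (0ℚ Q.< x × x Q.≤ 1ℚ) × ValidItems xs

Assignment : List ℚ → ℕ → Set
Assignment I k = Fin (length I) → Fin k

load : (I : List ℚ) {k : ℕ} → Assignment I k → Fin k → ℚ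
load I f j = sumℚ (map (λ i → sizeIf i (f i ≟ j)) (allFin (length I)))
  where
  open import Relation.Nullary using (Dec)
  open import Relation.Binary.PropositionalEquality using (_≡_)
  sizeIf : (i : Fin (length I)) → Dec (f i ≡ j) → ℚ
  sizeIf i (yes _) = lookup I i
  sizeIf i (no _)  = 0ℚ

Feasible : (I : List ℚ) {k : ℕ} → Assignment I k → Set
Feasible I {k} f = (j : Fin k) → load I f j Q.≤ 1ℚ

PackableIn : List ℚ → ℕ → Set
PackableIn I k = Σ (Assignment I k) (λ f → Feasible I f)

IsOPT : List ℚ → ℕ → Set
IsOPT I m = PackableIn I m × ((k : ℕ) → k Data.Nat.< m → ¬ PackableIn I k)

-- State: list of current loads of the open bins.
-- bestLoad x ls: the largest load l in ls with l + x ≤ 1 (if any).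
bestLoad : ℚ → List ℚ → Maybe ℚ
bestLoad x [] = nothing
bestLoad x (l ∷ ls) with (l + x) Q.≤? 1ℚ
... | no _ = bestLoad x ls
... | yes _ with bestLoad x ls
...   | nothing = just l
...   | just b with l Q.≤? b
...     | yes _ = just b
...     | no _  = just l

replaceFirst : ℚ → ℚ → List ℚ → List ℚ
replaceFirst b b' [] = []
replaceFirst b b' (l ∷ ls) with l Q.≟ b
... | yes _ = b' ∷ ls
... | no _  = l ∷ replaceFirst b b' ls

bfStep : List ℚ → ℚ → List ℚ
bfStep ls x with bestLoad x ls
... | nothing = ls ++ [ x ]
... | just b  = replaceFirst b (b + x) ls

BF : List ℚ → ℕ
BF I = length (foldl bfStep [] I)

-- All orderings I^σ, σ ∈ S_n (one list entry per permutation σ, so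
-- n! entries, with repetitions when items coincide).

insertions : {A : Set} → A → List A → List (List A)
insertions x [] = [ x ∷ [] ]
insertions x (y ∷ ys) = (x ∷ y ∷ ys) ∷ map (y ∷_) (insertions x ys)

permutations : {A : Set} → List A → List (List A)
permutations [] = [ [] ]
permutations (x ∷ xs) = concatMap (insertions x) (permutations xs)

-- Take three items of size 1/3 and two of size 5/12. Their total 11/6 exceeds one bin,
-- and {1/3, 1/3, 1/3}, {5/12, 5/12} is a packing, so OPT = 2. Best Fit also uses two bins
-- exactly when the two items of size 5/12 end up together: when they are the first two
-- items, or when the first of them comes after two items of size 1/3. Otherwise a 5/12
-- shares a bin with a 1/3 and three bins are needed. Of the 10 equally likely placements
-- of the two large items 4 give two bins, so E[BF] = (4·2 + 6·3)/10 = 13/5 = (13/10)·OPT.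
module Submission where

open import Defs
open import Data.Nat using (ℕ; _*_; _!; _≤_; _<_; zero; suc; s≤s; z≤n)
open import Data.List using (List; length; map; []; _∷_)
open import Data.Nat.ListAction using (sum)
open import Data.Product using (Σ; _×_; _,_)
open import Data.Rational using (ℚ; _/_; 0ℚ; 1ℚ; _≤?_; _<?_)
import Data.Rational as Q
open import Data.Integer using (+_)
open import Data.Fin using (Fin; zero; suc; _≟_)
open import Data.Fin.Properties using (¬Fin0)
open import Data.Unit using (tt)
open import Relation.Nullary using (¬_; yes; no; contradiction)
open import Relation.Binary.PropositionalEquality using (_≡_; refl; cong)
open import Relation.Nullary.Decidable using (toWitness; toWitnessFalse)

third fiveTwelfths : ℚ
third = + 1 / 3
fiveTwelfths = + 5 / 12

items : List ℚ
items = third ∷ third ∷ third ∷ fiveTwelfths ∷ fiveTwelfths ∷ []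

items-valid : ValidItems items
items-valid = third-valid , third-valid , third-valid , fiveTwelfths-valid , fiveTwelfths-valid , tt
  where
  third-valid : 0ℚ Q.< third × third Q.≤ 1ℚ
  third-valid = toWitness {a? = 0ℚ <? third} tt , toWitness {a? = third ≤? 1ℚ} tt
  fiveTwelfths-valid : 0ℚ Q.< fiveTwelfths × fiveTwelfths Q.≤ 1ℚ
  fiveTwelfths-valid = toWitness {a? = 0ℚ <? fiveTwelfths} tt , toWitness {a? = fiveTwelfths ≤? 1ℚ} tt

thirds-apart-from-large : Assignment items 2
thirds-apart-from-large zero = zero
thirds-apart-from-large (suc zero) = zero
thirds-apart-from-large (suc (suc zero)) = zero
thirds-apart-from-large (suc (suc (suc _))) = suc zero

packable-in-two : PackableIn items 2
packable-in-two = thirds-apart-from-large , feasible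
  where
  feasible : Feasible items thirds-apart-from-large
  feasible zero = toWitness {a? = load items thirds-apart-from-large zero ≤? 1ℚ} tt
  feasible (suc zero) = toWitness {a? = load items thirds-apart-from-large (suc zero) ≤? 1ℚ} tt

Fin1-unique : (x : Fin 1) → x ≡ zero
Fin1-unique zero = refl

single-bin-overfull : (f : Assignment items 1) → ¬ load items f zero Q.≤ 1ℚ
single-bin-overfull f
  with f zero ≟ zero | f (suc zero) ≟ zero | f (suc (suc zero)) ≟ zero
     | f (suc (suc (suc zero))) ≟ zero | f (suc (suc (suc (suc zero)))) ≟ zero
... | yes _ | yes _ | yes _ | yes _ | yes _ = toWitnessFalse {a? = sumℚ items ≤? 1ℚ} tt
... | no f0≢0 | _ | _ | _ | _ = contradiction (Fin1-unique _) f0≢0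
... | _ | no f1≢0 | _ | _ | _ = contradiction (Fin1-unique _) f1≢0
... | _ | _ | no f2≢0 | _ | _ = contradiction (Fin1-unique _) f2≢0
... | _ | _ | _ | no f3≢0 | _ = contradiction (Fin1-unique _) f3≢0
... | _ | _ | _ | _ | no f4≢0 = contradiction (Fin1-unique _) f4≢0

not-packable-below-two : (k : ℕ) → k < 2 → ¬ PackableIn items k
not-packable-below-two zero _ (f , _) = ¬Fin0 (f zero)
not-packable-below-two (suc zero) _ (f , feasible) = single-bin-overfull f (feasible zero)
not-packable-below-two (suc (suc _)) (s≤s (s≤s ()))

items-OPT : IsOPT items 2
items-OPT = packable-in-two , not-packable-below-two

sum-BF-over-orderings : sum (map BF (permutations items)) ≡ 312
sum-BF-over-orderings = refl

lemma16 : Σ (List ℚ) (λ I → Σ ℕ (λ m →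
    1 ≤ length I × ValidItems I × IsOPT I m ×
    (10 * sum (map BF (permutations I)) ≡ 13 * m * (length I) !)))
lemma16 = items , 2 , s≤s z≤n , items-valid , items-OPT , cong (10 *_) sum-BF-over-orderings
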